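{- Let $\gamma$ be a garden, $\mathbf x,\mathbf y$ sprinklers, $\Phi$ a bouquet, $\Delta$ a corolla, and $\sigma:\mathbf y$ a substitution capture-avoiding in $\Phi$. Then $\gamma\rhd\mathbf x\cdot\sigma(\Phi);\Delta\ \models\ \gamma\rhd(\mathbf x\cup\mathbf y)\cdot\Phi;\Delta$.
   Context: Fix a countable set $\mathcal{V}$ of variables and a first-order signature: a countable set $\mathcal{P}$ of predicate symbols with arities $\mathrm{ar}:\mathcal{P}\to\mathbb{N}$. Flowers and gardens by mutual induction: atoms $p(\vec x)$ ($\vec x\in\mathcal V^{\mathrm{ar}(p)}$) are flowers; if $\mathbf{x}\subset\mathcal{V}$ is finite (a sprinkler) and $\Phi$ a finite multiset of flowers (a bouquet), $\mathbf{x}\cdot\Phi$ is a garden; if $\gamma$ is a garden (pistil) and $\Delta$ a finite multiset of gardens (a corolla of petals), $\gamma\rhd\Delta$ is a flower; $\gamma\rhd\delta;\Delta$ denotes the flower whose petals are $\delta$ together with those of $\Delta$. Free variables: $\mathrm{fv}(p(\vec x))$ = variables of $\vec x$; $\mathrm{fv}(\Phi)=\bigcup\mathrm{fv}(\phi)$; $\mathrm{fv}(\mathbf{x}\cdot\Phi)=\mathrm{fv}(\Phi)\setminus\mathbf{x}$; $\mathrm{fv}(\mathbf{x}\cdot\Phi\rhd\Delta)=\mathrm{fv}(\mathbf{x}\cdot\Phi)\cup\bigcup_{\mathbf{y}\cdot\Psi\in\Delta}\mathrm{fv}((\mathbf{x}\cup\mathbf{y})\cdot\Psi)$. Bound variables: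 $\mathrm{bv}(p(\vec x))=\emptyset$, $\mathrm{bv}(\Phi)=\bigcup\mathrm{bv}(\phi)$, $\mathrm{bv}(\mathbf x\cdot\Phi)=\mathbf x\cup\mathrm{bv}(\Phi)$, $\mathrm{bv}(\gamma\rhd\Delta)=\mathrm{bv}(\gamma)\cup\bigcup_{\delta\in\Delta}\mathrm{bv}(\delta)$. Standing convention: every flower/bouquet considered has pairwise distinct binders and $\mathrm{bv}\cap\mathrm{fv}=\emptyset$. Updates and substitutions: $f[R\mapsto g]$ equals $g$ on $R$ and $f$ elsewhere. A substitution is $\sigma:\mathcal V\to\mathcal V$ with finite support; $\sigma:\mathbf y$ means support $\mathbf y$; $\sigma_{ -\mathbf x}:=\sigma[\mathbf x\mapsto\mathrm{id}]$. Action: $\sigma(p(x_1,\dots,x_n))=p(\sigma(x_1),\dots,\sigma(x_n))$, elementwise on bouquets, $\sigma(\mathbf x\cdot\Phi)=\mathbf x\cdot\sigma_{ -\mathbf x}(\Phi)$, $\sigma(\mathbf x\cdot\Phi\rhd\delta_1;\dots;\delta_n)=\sigma(\mathbf x\cdot\Phi)\rhd\sigma_{ -\mathbf x}(\delta_1);\dots;\sigma_{ -\mathbf x}(\delta_n)$. $\sigma:\mathbf y$ is capture-avoiding in $\Phi$ if $\sigma(\mathbf y)\cap\mathrm{bv}(\Phi)=\emptyset$. Semantics: a Kripke structure $(W,\le,(M_w)_{w\in W})$ has a preorder $\le$ on worlds and for each $w$ a nonempty domain $M_w$ and relations $[\![p]\!]_w\subseteq M_w^{\mathrm{ar}(p)}$,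 monotone along $\le$. A $w$-evaluation is $e:\mathcal V\to M_w$. Forcing: $w\Vdash_e p(x_1,\dots,x_n)$ iff $(e(x_1),\dots,e(x_n))\in[\![p]\!]_w$; $w\Vdash_e\Phi$ iff $w\Vdash_e\phi$ for all $\phi\in\Phi$; $w\Vdash_e(\mathbf x\cdot\Phi\rhd\mathbf x_1\cdot\Phi_1;\dots;\mathbf x_n\cdot\Phi_n)$ iff for every $w'\ge w$ and $w'$-evaluation $e'$ with $w'\Vdash_{e[\mathbf x\mapsto e']}\Phi$, there are $i$ and a $w'$-evaluation $e''$ with $w'\Vdash_{e[\mathbf x\mapsto e'][\mathbf x_i\mapsto e'']}\Phi_i$. For flowers $\phi,\psi$, $\phi\models\psi$ means that in every Kripke structure, at every world $w$ and $w$-evaluation $e$, $w\Vdash_e\phi$ implies $w\Vdash_e\psi$. -}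

module Defs where

open import Data.Nat using (ℕ; _≟_)
open import Data.List using (List; []; _∷_; _++_; filter)
open import Data.Vec using (Vec; toList)
import Data.Vec as Vec
open import Data.Vec.Relation.Unary.All using (All)
open import Data.Bool using (if_then_else_)
open import Data.Empty using (⊥)
open import Data.Unit using (⊤)
open import Data.Product using (Σ; _×_)
open import Data.Sum using (_⊎_)
open import Relation.Nullary using (¬_; ¬?; does)
open import Relation.Binary.PropositionalEquality using (_≡_)
open import Data.List.Membership.Propositional using (_∈_)
open import Data.List.Membership.DecPropositional _≟_ using (_∈?_)
open import Data.List.Relation.Unary.Unique.Propositional using (Unique)

Var : Set
Var = ℕ

-- A sprinkler (finite set of variables) is represented by a list.
Sprinkler : Set
Sprinkler = List Var

_∖_ : List Var → Sprinkler → List Var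
l ∖ x = filter (λ v → ¬? (v ∈? x)) l

_∪ˢ_ : Sprinkler → Sprinkler → Sprinkler
x ∪ˢ y = x ++ (y ∖ x)

_[_↦_] : {A : Set} → (Var → A) → Sprinkler → (Var → A) → (Var → A)
(f [ R ↦ g ]) v = if does (v ∈? R) then g v else f v

module Sig (ar : ℕ → ℕ) where

  mutual
    data Flower : Set where
      atom : (p : ℕ) → Vec Var (ar p) → Flower
      _▷_  : Garden → List Garden → Flower   -- pistil ▷ corolla (multiset as list)

    data Garden : Set where
      _·_ : Sprinkler → List Flower → Garden

  Bouquet : Set
  Bouquet = List Flower

  Corolla : Set
  Corolla = List Garden

  mutual
    fvF : Flower → List Var
    fvF (atom p xs) = toList xs
    fvF ((x · Φ) ▷ Δ) = (fvB Φ ∖ x) ++ fvPetals x Δ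

    fvB : Bouquet → List Var
    fvB [] = []
    fvB (φ ∷ Φ) = fvF φ ++ fvB Φ

    fvPetals : Sprinkler → Corolla → List Var
    fvPetals x [] = []
    fvPetals x ((y · Ψ) ∷ Δ) = (fvB Ψ ∖ (x ∪ˢ y)) ++ fvPetals x Δ

  fvG : Garden → List Var
  fvG (x · Φ) = fvB Φ ∖ x

  -- bound variables, as the list of all binder occurrences
  -- (concatenation of all sprinklers occurring in the term)
  mutual
    bvF : Flower → List Var
    bvF (atom p xs) = []
    bvF (γ ▷ Δ) = bvG γ ++ bvC Δ

    bvB : Bouquet → List Var
    bvB [] = []
    bvB (φ ∷ Φ) = bvF φ ++ bvB Φ

    bvG : Garden → List Var
    bvG (x · Φ) = x ++ bvB Φ

    bvC : Corolla → List Var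
    bvC [] = []
    bvC (δ ∷ Δ) = bvG δ ++ bvC Δ

  WellFormed : Flower → Set
  WellFormed φ = Unique (bvF φ) × (∀ v → v ∈ bvF φ → ¬ (v ∈ fvF φ))

  Subst : Set
  Subst = Var → Var

  _₋_ : Subst → Sprinkler → Subst
  σ ₋ x = σ [ x ↦ (λ v → v) ]

  mutual
    substF : Subst → Flower → Flower
    substF σ (atom p xs) = atom p (Vec.map σ xs)
    substF σ ((x · Φ) ▷ Δ) = (x · substB (σ ₋ x) Φ) ▷ substC (σ ₋ x) Δ

    substB : Subst → Bouquet → Bouquet
    substB σ [] = []
    substB σ (φ ∷ Φ) = substF σ φ ∷ substB σ Φ

    substG : Subst → Garden → Garden
    substG σ (x · Φ) = x · substB (σ ₋ x) Φ

    substC : Subst → Corolla → Corolla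
    substC σ [] = []
    substC σ (δ ∷ Δ) = substG σ δ ∷ substC σ Δ

  HasSupport : Subst → Sprinkler → Set
  HasSupport σ y = ∀ v → (v ∈ y → ¬ (σ v ≡ v)) × (¬ (σ v ≡ v) → v ∈ y)

  CaptureAvoiding : Subst → Sprinkler → Bouquet → Set
  CaptureAvoiding σ y Φ = ∀ v → v ∈ y → ¬ (σ v ∈ bvB Φ)

  -- Kripke structures. Increasing domains M_w are represented as
  -- subsets of a common carrier D (so M_w ⊆ M_w' for w ≤ w').
  record Kripke : Set₁ where
    field
      W      : Set
      _≤_    : W → W → Set
      ≤-refl : ∀ {w} → w ≤ w
      ≤-trans : ∀ {w w′ w″} → w ≤ w′ → w′ ≤ w″ → w ≤ w″
      D      : Set
      M      : W → D → Set
      M-nonempty : ∀ w → Σ D (M w)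
      M-mono : ∀ {w w′} → w ≤ w′ → ∀ d → M w d → M w′ d
      rel    : (p : ℕ) → W → Vec D (ar p) → Set
      rel-dom : ∀ p w ds → rel p w ds → All (M w) ds
      rel-mono : ∀ p {w w′} → w ≤ w′ → ∀ ds → rel p w ds → rel p w′ ds

  module _ (K : Kripke) where
    open Kripke K

    IsEval : W → (Var → D) → Set
    IsEval w e = ∀ v → M w (e v)

    mutual
      forceF : W → (Var → D) → Flower → Set
      forceF w e (atom p xs) = rel p w (Vec.map e xs)
      forceF w e ((x · Φ) ▷ Δ) =
        ∀ w′ → w ≤ w′ → ∀ e′ → IsEval w′ e′ →
        forceB w′ (e [ x ↦ e′ ]) Φ → forcePetals w′ (e [ x ↦ e′ ]) Δ

      forceB : W → (Var → D) → Bouquet → Set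
      forceB w e [] = ⊤
      forceB w e (φ ∷ Φ) = forceF w e φ × forceB w e Φ

      forcePetals : W → (Var → D) → Corolla → Set
      forcePetals w e [] = ⊥
      forcePetals w e ((y · Ψ) ∷ Δ) =
        Σ (Var → D) (λ e″ → IsEval w e″ × forceB w (e [ y ↦ e″ ]) Ψ)
        ⊎ forcePetals w e Δ

  _⊨_ : Flower → Flower → Set₁
  φ ⊨ ψ = ∀ (K : Kripke) (w : Kripke.W K) (e : Var → Kripke.D K) →
          IsEval K w e → forceF K w e φ → forceF K w e ψ

{-# OPTIONS --safe #-}
-- Forcing commutes with substitution: w ⊩_f σ(φ) iff w ⊩_{f ∘ σ} φ, provided σ
-- sends no variable it moves onto a binder of φ (only then does σ_{-x} under a
-- binder x agree with σ composed with the updated evaluation). Given a witness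
-- e″ for the petal x · σ(Φ), the evaluation (e[x ↦ e″]) ∘ σ is therefore a
-- witness for (x ∪ y) · Φ: it already agrees with e outside x ∪ y, because σ is
-- the identity there.
module Submission where

open import Data.Nat using (ℕ; _≟_)
open import Data.List using (List; []; _∷_; _++_)
open import Data.Product using (_×_; _,_; proj₂; Σ)
open import Data.Product.Function.NonDependent.Propositional using (_×-⇔_)
import Data.Product as Product
open import Data.Sum.Function.Propositional using (_⊎-⇔_)
import Data.Sum as Sum
open import Data.Empty using (⊥-elim)
open import Function using (_∘_; id)
open import Function.Bundles using (_⇔_; mk⇔; Equivalence)
open import Function.Construct.Identity using (⇔-id)
open import Relation.Nullary using (yes; no; ¬?)
open import Relation.Binary.PropositionalEquality using (_≡_; _≢_; refl; sym; trans; cong; subst)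
open import Data.List.Membership.Propositional using (_∈_; _∉_)
open import Data.List.Membership.DecPropositional _≟_ using (_∈?_)
open import Data.List.Membership.Propositional.Properties using (∈-++⁺ˡ; ∈-++⁺ʳ; ∈-filter⁺)
import Data.Vec as Vec
open import Data.Vec.Properties using (map-∘; map-cong)
open import Defs

open Equivalence using (to; from)

infix 4 _≈_
_≈_ : {A : Set} → (Var → A) → (Var → A) → Set
f ≈ g = ∀ v → f v ≡ g v

∈-∪ˢ⁺ˡ : ∀ {v} x y → v ∈ x → v ∈ x ∪ˢ y
∈-∪ˢ⁺ˡ x y = ∈-++⁺ˡ

∈-∪ˢ⁺ʳ : ∀ {v} x y → v ∈ y → v ∈ x ∪ˢ y
∈-∪ˢ⁺ʳ {v} x y v∈y with v ∈? x
... | yes v∈x = ∈-++⁺ˡ v∈x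
... | no v∉x = ∈-++⁺ʳ x (∈-filter⁺ (λ u → ¬? (u ∈? x)) v∈y v∉x)

module _ {A : Set} (f g : Var → A) {R : Sprinkler} {v : Var} where

  update-∈ : v ∈ R → (f [ R ↦ g ]) v ≡ g v
  update-∈ v∈R with v ∈? R
  ... | yes _ = refl
  ... | no v∉R = ⊥-elim (v∉R v∈R)

  update-∉ : v ∉ R → (f [ R ↦ g ]) v ≡ f v
  update-∉ v∉R with v ∈? R
  ... | yes v∈R = ⊥-elim (v∉R v∈R)
  ... | no _ = refl

update-≈-outside : ∀ {A : Set} {h k : Var → A} R →
                   (∀ v → v ∉ R → k v ≡ h v) → h [ R ↦ k ] ≈ k
update-≈-outside R agree v with v ∈? R
... | yes _ = refl
... | no v∉R = sym (agree v v∉R)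

RangeAvoids : (Var → Var) → List Var → Set
RangeAvoids τ L = ∀ v → τ v ≢ v → τ v ∉ L

RangeAvoids-++⁻ˡ : ∀ {τ} L L′ → RangeAvoids τ (L ++ L′) → RangeAvoids τ L
RangeAvoids-++⁻ˡ L L′ avoids v moved = avoids v moved ∘ ∈-++⁺ˡ

RangeAvoids-++⁻ʳ : ∀ {τ} L L′ → RangeAvoids τ (L ++ L′) → RangeAvoids τ L′
RangeAvoids-++⁻ʳ L L′ avoids v moved = avoids v moved ∘ ∈-++⁺ʳ L

RangeAvoids-update-id : ∀ {τ L} b → RangeAvoids τ L → RangeAvoids (τ [ b ↦ id ]) L
RangeAvoids-update-id b avoids v moved with v ∈? b
... | yes _ = ⊥-elim (moved refl)
... | no _ = avoids v moved

RangeAvoids⇒∉ : ∀ {τ L v} → RangeAvoids τ L → v ∉ L → τ v ∉ L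
RangeAvoids⇒∉ {τ} {v = v} avoids v∉L with τ v ≟ v
... | yes τv≡v = subst (_∉ _) (sym τv≡v) v∉L
... | no moved = avoids v moved

update-≈-∘-update-id : ∀ {A : Set} {f g e′ : Var → A} {τ} b → RangeAvoids τ b →
                       g ≈ f ∘ τ → g [ b ↦ e′ ] ≈ (f [ b ↦ e′ ]) ∘ (τ [ b ↦ id ])
update-≈-∘-update-id {f = f} {e′ = e′} {τ} b avoids g≈fτ v with v ∈? b
... | yes v∈b = sym (update-∈ f e′ v∈b)
... | no v∉b = trans (g≈fτ v) (sym (update-∉ f e′ (RangeAvoids⇒∉ avoids v∉b)))

module Semantics (ar : ℕ → ℕ) (K : Sig.Kripke ar) where
  open Sig ar
  open Kripke K

  IsEval-mono : ∀ {w w′ e} → w ≤ w′ → IsEval K w e → IsEval K w′ e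
  IsEval-mono w≤w′ ev v = M-mono w≤w′ _ (ev v)

  IsEval-update : ∀ {w f g} R → IsEval K w f → IsEval K w g → IsEval K w (f [ R ↦ g ])
  IsEval-update R evf evg v with v ∈? R
  ... | yes _ = evg v
  ... | no _ = evf v

  forceAtom-subst : ∀ {w} {f g : Var → D} τ p xs → g ≈ f ∘ τ →
                    forceF K w f (substF τ (atom p xs)) ⇔ forceF K w g (atom p xs)
  forceAtom-subst {w} {f} {g} τ p xs g≈fτ =
    mk⇔ (subst (rel p w) map-f∘τ≡map-g) (subst (rel p w) (sym map-f∘τ≡map-g))
    where
    map-f∘τ≡map-g : Vec.map f (Vec.map τ xs) ≡ Vec.map g xs
    map-f∘τ≡map-g = trans (sym (map-∘ f τ xs)) (map-cong (sym ∘ g≈fτ) xs)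

  mutual
    forceF-subst : ∀ {w} {f g : Var → D} τ φ → RangeAvoids τ (bvF φ) → g ≈ f ∘ τ →
                   forceF K w f (substF τ φ) ⇔ forceF K w g φ
    forceF-subst τ (atom p xs) _ g≈fτ = forceAtom-subst τ p xs g≈fτ
    forceF-subst {f = f} {g} τ ((b · Ψ) ▷ Δ) avoids g≈fτ = mk⇔
      (λ H w′ le e′ ev → to (petals w′ e′) ∘ H w′ le e′ ev ∘ from (pistil w′ e′))
      (λ H w′ le e′ ev → from (petals w′ e′) ∘ H w′ le e′ ev ∘ to (pistil w′ e′))
      where
      pistil : ∀ w′ e′ → forceB K w′ (f [ b ↦ e′ ]) (substB (τ ₋ b) Ψ)
                       ⇔ forceB K w′ (g [ b ↦ e′ ]) Ψ
      pistil w′ = forceB-subst-under τ b Ψ (RangeAvoids-++⁻ˡ (b ++ bvB Ψ) (bvC Δ) avoids) g≈fτ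

      petals : ∀ w′ e′ → forcePetals K w′ (f [ b ↦ e′ ]) (substC (τ ₋ b) Δ)
                       ⇔ forcePetals K w′ (g [ b ↦ e′ ]) Δ
      petals w′ e′ = forcePetals-subst (τ ₋ b) Δ
        (RangeAvoids-update-id b (RangeAvoids-++⁻ʳ (b ++ bvB Ψ) (bvC Δ) avoids))
        (update-≈-∘-update-id {f = f} {g} {e′} b
          (RangeAvoids-++⁻ˡ b (bvB Ψ) (RangeAvoids-++⁻ˡ (b ++ bvB Ψ) (bvC Δ) avoids)) g≈fτ)

    forceB-subst : ∀ {w} {f g : Var → D} τ Φ → RangeAvoids τ (bvB Φ) → g ≈ f ∘ τ →
                   forceB K w f (substB τ Φ) ⇔ forceB K w g Φ
    forceB-subst τ [] _ _ = ⇔-id _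
    forceB-subst τ (φ ∷ Φ) avoids g≈fτ =
      forceF-subst τ φ (RangeAvoids-++⁻ˡ (bvF φ) (bvB Φ) avoids) g≈fτ
      ×-⇔ forceB-subst τ Φ (RangeAvoids-++⁻ʳ (bvF φ) (bvB Φ) avoids) g≈fτ

    forceB-subst-under : ∀ {w} {f g : Var → D} τ b Ψ → RangeAvoids τ (b ++ bvB Ψ) →
                         g ≈ f ∘ τ → ∀ e′ →
                         forceB K w (f [ b ↦ e′ ]) (substB (τ ₋ b) Ψ)
                         ⇔ forceB K w (g [ b ↦ e′ ]) Ψ
    forceB-subst-under {f = f} {g} τ b Ψ avoids g≈fτ e′ =
      forceB-subst (τ ₋ b) Ψ (RangeAvoids-update-id b (RangeAvoids-++⁻ʳ b (bvB Ψ) avoids))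
        (update-≈-∘-update-id {f = f} {g} {e′} b (RangeAvoids-++⁻ˡ b (bvB Ψ) avoids) g≈fτ)

    forcePetals-subst : ∀ {w} {f g : Var → D} τ Δ → RangeAvoids τ (bvC Δ) → g ≈ f ∘ τ →
                        forcePetals K w f (substC τ Δ) ⇔ forcePetals K w g Δ
    forcePetals-subst τ [] _ _ = ⇔-id _
    forcePetals-subst τ ((b · Ψ) ∷ Δ) avoids g≈fτ =
      mk⇔ (Product.map₂ (Product.map₂ (to (petal _))))
          (Product.map₂ (Product.map₂ (from (petal _))))
      ⊎-⇔ forcePetals-subst τ Δ (RangeAvoids-++⁻ʳ (b ++ bvB Ψ) (bvC Δ) avoids) g≈fτ
      where
      petal = forceB-subst-under τ b Ψ (RangeAvoids-++⁻ˡ (b ++ bvB Ψ) (bvC Δ) avoids) g≈fτ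

  ForcesGarden : W → (Var → D) → Garden → Set
  ForcesGarden w e (y · Ψ) = Σ (Var → D) λ e″ → IsEval K w e″ × forceB K w (e [ y ↦ e″ ]) Ψ

  forcesGarden-widen-subst : ∀ {w e} x y Φ σ → HasSupport σ y → CaptureAvoiding σ y Φ →
    IsEval K w e → ForcesGarden w e (x · substB σ Φ) → ForcesGarden w e ((x ∪ˢ y) · Φ)
  forcesGarden-widen-subst {w} {e} x y Φ σ support avoids ev (e″ , ev″ , ⊩σΦ) =
    f ∘ σ , IsEval-σ , to (forceB-subst σ Φ σ-avoids-bv widened≈f∘σ) ⊩σΦ
    where
    f = e [ x ↦ e″ ]

    IsEval-σ : IsEval K w (f ∘ σ)
    IsEval-σ = IsEval-update x ev ev″ ∘ σ

    σ-avoids-bv : RangeAvoids σ (bvB Φ)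
    σ-avoids-bv v moved = avoids v (proj₂ (support v) moved)

    fixed-outside : ∀ v → v ∉ y → σ v ≡ v
    fixed-outside v v∉y with σ v ≟ v
    ... | yes σv≡v = σv≡v
    ... | no moved = ⊥-elim (v∉y (proj₂ (support v) moved))

    widened≈f∘σ : e [ x ∪ˢ y ↦ f ∘ σ ] ≈ f ∘ σ
    widened≈f∘σ = update-≈-outside (x ∪ˢ y) λ v v∉x∪y →
      trans (cong f (fixed-outside v (v∉x∪y ∘ ∈-∪ˢ⁺ʳ x y)))
            (update-∉ e e″ (v∉x∪y ∘ ∈-∪ˢ⁺ˡ x y))

  forceF-widen-subst-petal : ∀ {w e} γ x y Φ Δ σ → HasSupport σ y → CaptureAvoiding σ y Φ →
    IsEval K w e →
    forceF K w e (γ ▷ ((x · substB σ Φ) ∷ Δ)) → forceF K w e (γ ▷ (((x ∪ˢ y) · Φ) ∷ Δ))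
  forceF-widen-subst-petal (z · Γ) x y Φ Δ σ support avoids ev H w′ w≤w′ e′ ev′ ⊩Γ =
    Sum.map₁ (forcesGarden-widen-subst x y Φ σ support avoids
                (IsEval-update z (IsEval-mono w≤w′ ev) ev′))
             (H w′ w≤w′ e′ ev′ ⊩Γ)

mainTheorem18 : (ar : ℕ → ℕ) → let open Sig ar in
    (γ : Garden) (x y : Sprinkler) (Φ : Bouquet) (Δ : Corolla) (σ : Subst) →
    HasSupport σ y → CaptureAvoiding σ y Φ →
    WellFormed (γ ▷ ((x · substB σ Φ) ∷ Δ)) →
    WellFormed (γ ▷ (((x ∪ˢ y) · Φ) ∷ Δ)) →
    (γ ▷ ((x · substB σ Φ) ∷ Δ)) ⊨ (γ ▷ (((x ∪ˢ y) · Φ) ∷ Δ))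
mainTheorem18 ar γ x y Φ Δ σ support avoids _ _ K w e =
  Semantics.forceF-widen-subst-petal ar K γ x y Φ Δ σ support avoids
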